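{- Let $q$ be a prime power, $r\geqslant2$, $\mathcal{A}\subseteq\mathbb{F}_{q^r}$, $e\mid q^r-1$, and suppose $\mathrm{rad}(e)=k\prod_{i=1}^{s_1}p_i\prod_{j=1}^{s_2}l_j$ with $k$ a positive integer and $p_i,l_j$ primes. Then $$N(e,\mathcal{A})\geqslant N(kp_1\cdots p_{s_1},\mathcal{A})-\epsilon(l_1,\dots,l_{s_2})|\mathcal{A}|+\sum_{j=1}^{s_2}\left(N(l_j,\mathcal{A})-\left(1-\frac1{l_j}\right)|\mathcal{A}|\right),$$ where $\epsilon(l_1,\dots,l_{s_2})=\sum_{j=1}^{s_2}\frac1{l_j}$.
   Context: An element $\gamma\in\mathbb{F}_{q^r}^*$ is $m$-free (for $m\mid q^r-1$) if there is no $\beta\in\mathbb{F}_{q^r}^*$ with $\gamma=\beta^{d}$ for some $d\mid m$, $d\neq1$. $N(m,\mathcal{A})$ is the number of $m$-free elements of $\mathcal{A}$. $\mathrm{rad}(n)$ is the product of the distinct primes dividing $n$. -}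

module Defs where

open import Level using (0ℓ)
open import Data.Bool using (Bool; T)
open import Data.Nat as ℕ using (ℕ; zero; suc; _≤_; _<_; NonZero; s≤s)
open import Data.Nat.Properties using (*-identityʳ; m*n≢0)
open import Data.Nat.Divisibility using (_∣_; _∣?_; ∣⇒≤)
open import Data.Nat.Primality using (Prime; prime?; prime⇒nonZero)
open import Data.Fin using (Fin; toℕ; fromℕ<)
open import Data.Fin.Properties using (any?; toℕ-fromℕ<)
open import Data.List using (List; []; _∷_; length; filter; map; upTo; foldr)
open import Data.Nat.ListAction using (product)
open import Data.Integer using (+_)
open import Data.List.Membership.Propositional using (_∈_)
open import Data.List.Relation.Unary.Any using (Any; here; there)
open import Data.List.Relation.Unary.Unique.Propositional using (Unique)
open import Data.Product using (Σ; ∃; ∃-syntax; _×_; _,_; proj₁; proj₂)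
open import Data.Product.Properties using ()
open import Relation.Nullary using (Dec; yes; no; ¬_)
open import Relation.Nullary.Decidable using (_×-dec_; ¬?; T?)
open import Relation.Binary.PropositionalEquality using (_≡_; _≢_; refl; subst; sym)
open import Algebra.Structures using (IsCommutativeRing)
open import Data.Rational as ℚ using (ℚ)

record FiniteField : Set₁ where
  field
    Carrier   : Set
    _+_ _*_   : Carrier → Carrier → Carrier
    -_        : Carrier → Carrier
    0# 1#     : Carrier
    isCommutativeRing : IsCommutativeRing _≡_ _+_ _*_ -_ 0# 1#
    0≢1       : 0# ≢ 1#
    inverse   : ∀ x → x ≢ 0# → ∃[ y ] (x * y ≡ 1#)
    _≟_       : (x y : Carrier) → Dec (x ≡ y)
    elements  : List Carrier
    complete  : ∀ x → x ∈ elements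
    unique    : Unique elements

  card : ℕ
  card = length elements

  pow : Carrier → ℕ → Carrier
  pow x zero    = 1#
  pow x (suc n) = x * pow x n

  IsFree : ℕ → Carrier → Set
  IsFree m γ = γ ≢ 0# × ¬ (∃[ β ] ∃[ d ] (β ≢ 0# × d ∣ m × d ≢ 1 × γ ≡ pow β d))

  -- decidability of m-freeness (for m ≠ 0, which is always the case
  -- since m ∣ q^r - 1)
  private
    Inner : ℕ → Carrier → Carrier → ℕ → Set
    Inner m γ β d = β ≢ 0# × d ∣ m × d ≢ 1 × γ ≡ pow β d

    inner? : ∀ m γ β d → Dec (Inner m γ β d)
    inner? m γ β d = ¬? (β ≟ 0#) ×-dec ((d ∣? m) ×-dec (¬? (d ℕ.≟ 1) ×-dec (γ ≟ pow β d)))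

    anyList : {P : Carrier → Set} → (∀ x → Dec (P x)) → (xs : List Carrier) →
              Dec (∃[ x ] (x ∈ xs × P x))
    anyList P? [] = no λ { (_ , () , _) }
    anyList P? (x ∷ xs) with P? x | anyList P? xs
    ... | yes p | _ = yes (x , here refl , p)
    ... | no _  | yes (y , y∈ , p) = yes (y , there y∈ , p)
    ... | no ¬p | no ¬r = no λ { (y , here refl , p) → ¬p p
                               ; (y , there y∈ , p) → ¬r (y , y∈ , p) }

    dSearch : ∀ m .{{_ : NonZero m}} γ β → Dec (∃[ d ] Inner m γ β d)
    dSearch m γ β with any? {n = suc m} (λ i → inner? m γ β (toℕ i))
    ... | yes (i , p) = yes (toℕ i , p)
    ... | no ¬p = no λ { (d , p@(_ , d∣m , _)) →
           ¬p (fromℕ< (s≤s (∣⇒≤ d∣m)) ,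
               subst (Inner m γ β) (sym (toℕ-fromℕ< (s≤s (∣⇒≤ d∣m)))) p) }

  free? : ∀ m .{{_ : NonZero m}} γ → Dec (IsFree m γ)
  free? m γ with anyList (dSearch m γ) elements
  ... | yes (β , _ , d , p) = no λ { (_ , ¬e) → ¬e (β , d , p) }
  ... | no ¬e = Relation.Nullary.Decidable.map′
                  (λ γ≢0 → γ≢0 , λ { (β , d , p) → ¬e (β , complete β , d , p) })
                  proj₁ (¬? (γ ≟ 0#))

  Subset : Set
  Subset = Carrier → Bool

  size : Subset → ℕ
  size A = length (filter (λ γ → T? (A γ)) elements)

  N : (m : ℕ) → .{{_ : NonZero m}} → Subset → ℕ
  N m A = length (filter (λ γ → T? (A γ) ×-dec free? m γ) elements)

IsPrimePower : ℕ → Set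
IsPrimePower q = ∃[ p ] ∃[ a ] (Prime p × 1 ≤ a × q ≡ p ℕ.^ a)

rad : ℕ → ℕ
rad n = product (filter (λ p → prime? p ×-dec (p ∣? n)) (upTo (suc n)))

Primes : Set
Primes = List (Σ ℕ Prime)

prodP : Primes → ℕ
prodP ps = product (map proj₁ ps)

prodP-nonZero : (ps : Primes) → NonZero (prodP ps)
prodP-nonZero [] = _
prodP-nonZero ((p , pp) ∷ ps) =
  m*n≢0 p (prodP ps) {{prime⇒nonZero pp}} {{prodP-nonZero ps}}

sumℚ : List ℚ → ℚ
sumℚ = foldr ℚ._+_ ℚ.0ℚ

ℕtoℚ : ℕ → ℚ
ℕtoℚ n = + n ℚ./ 1

recipP : Σ ℕ Prime → ℚ
recipP (l , pl) = ℚ._/_ (+ 1) l {{prime⇒nonZero pl}}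

ε : Primes → ℚ
ε ls = sumℚ (map recipP ls)

-- An element is m-free exactly when it is nonzero and p-free for every prime p ∣ m, so
-- m-freeness only depends on the primes dividing m, and an element that is both m-free and
-- l-free is (m * l)-free. Inclusion–exclusion then gives N(m) + N(l) ≤ N(m l) + |𝒜|, and
-- adding l₁, …, l_s one at a time to m = k p₁ ⋯ p_{s₁} yields
-- N(e) ≥ N(m) + Σⱼ N(lⱼ) − s₂ |𝒜|, which is the claim since s₂ = ε + Σⱼ (1 − 1/lⱼ).
module Submission where

open import Defs
open import Data.Nat using (ℕ; _≤_; _*_; _^_; _∸_; NonZero)
open import Data.Nat.Properties using (m*n≢0)
open import Data.Nat.Divisibility using (_∣_)
open import Data.Nat.Primality using (prime⇒nonZero)
open import Data.List using (map)
open import Data.Product using (proj₁; proj₂)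
open import Relation.Binary.PropositionalEquality using (_≡_)
open import Data.Rational using (_+_; _-_; _≥_; 1ℚ) renaming (_*_ to _*ℚ_)

open import Algebra.Structures using (IsCommutativeRing)
open import Data.Bool using (T; true; false)
open import Data.Empty using (⊥-elim)
open import Data.Integer as ℤ using (+_)
import Data.Integer.Properties as ℤₚ
open import Data.List using ([]; _∷_; length; filter)
open import Data.List.Membership.Propositional.Properties using (∈-filter⁺; ∈-upTo⁺)
open import Data.List.Relation.Binary.Sublist.Heterogeneous.Properties using (length-mono-≤)
open import Data.List.Relation.Binary.Sublist.Propositional using (⊆-refl)
open import Data.List.Relation.Binary.Sublist.Propositional.Properties using (filter⁺)
open import Data.List.Relation.Unary.All using (_∷_)
import Data.Nat as ℕ
import Data.Nat.Properties as ℕₚ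
open import Data.Nat.Coprimality using (1-coprimeTo) renaming (sym to coprime-sym)
open import Data.Nat.Divisibility using (divides; ∣-refl; ∣-trans; ∣⇒≤; m∣m*n; 0∣⇒≡0; _∣?_)
open import Data.Nat.ListAction using (product)
open import Data.Nat.ListAction.Properties using (∈⇒∣product)
open import Data.Nat.Primality using (Prime; prime?; euclidsLemma; ¬prime[1])
open import Data.Nat.Primality.Factorisation using (factorise)
open import Data.Product using (Σ; ∃-syntax; _×_; _,_)
import Data.Rational as ℚ
open import Data.Rational using (ℚ; mkℚ; 0ℚ; _/_; *≤*)
import Data.Rational.Properties as ℚₚ
open import Data.Rational.Solver using (module +-*-Solver)
open import Data.Sum using ([_,_]′)
open import Relation.Binary.PropositionalEquality
  using (_≢_; refl; sym; trans; cong; cong₂; subst; subst₂)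
open import Relation.Nullary using (does; _×-dec_)
open import Relation.Nullary.Decidable using (T?)
open import Relation.Unary using (Pred; Decidable; _⊆_)
open import Relation.Unary.Properties using (_∩?_; _∪?_)

prime-divisor : ∀ {d} → d ≢ 0 → d ≢ 1 → ∃[ p ] (Prime p × p ∣ d)
prime-divisor {d} d≢0 d≢1 with factorise d {{ℕ.≢-nonZero d≢0}}
... | record { factors = [] ; isFactorisation = d≡1 } = ⊥-elim (d≢1 d≡1)
... | record { factors = p ∷ ps ; isFactorisation = d≡p*∏ps ; factorsPrime = p-prime ∷ _ } =
  p , p-prime , subst (p ∣_) (sym d≡p*∏ps) (m∣m*n (product ps))

PrimeDivisorsDivide : ℕ → ℕ → Set
PrimeDivisorsDivide n m = ∀ {p} → Prime p → p ∣ n → p ∣ m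

prime∣⇒∣rad : ∀ {n} .{{_ : NonZero n}} → PrimeDivisorsDivide n (rad n)
prime∣⇒∣rad {n} p-prime p∣n = ∈⇒∣product
  (∈-filter⁺ (λ p → prime? p ×-dec (p ∣? n)) (∈-upTo⁺ (ℕ.s≤s (∣⇒≤ p∣n))) (p-prime , p∣n))

module Freeness (F : FiniteField) where
  open FiniteField F using (0#; pow; IsFree; isCommutativeRing) renaming (_*_ to _·_)
  open IsCommutativeRing isCommutativeRing using (zeroˡ; *-identityˡ; *-assoc)

  pow-+ : ∀ x m n → pow x (m ℕ.+ n) ≡ pow x m · pow x n
  pow-+ x ℕ.zero    n = sym (*-identityˡ _)
  pow-+ x (ℕ.suc m) n = trans (cong (x ·_) (pow-+ x m n)) (sym (*-assoc x _ _))

  pow-* : ∀ x m n → pow x (m * n) ≡ pow (pow x n) m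
  pow-* x ℕ.zero    n = refl
  pow-* x (ℕ.suc m) n = trans (pow-+ x n (m * n)) (cong (pow x n ·_) (pow-* x m n))

  pow-0# : ∀ n .{{_ : NonZero n}} → pow 0# n ≡ 0#
  pow-0# (ℕ.suc n) = zeroˡ _

  free-∣ : ∀ {m d γ} → d ∣ m → IsFree m γ → IsFree d γ
  free-∣ d∣m (γ≢0 , ¬power) = γ≢0 , λ (β , c , β≢0 , c∣d , c≢1 , γ≡βᶜ) →
    ¬power (β , c , β≢0 , ∣-trans c∣d d∣m , c≢1 , γ≡βᶜ)

  -- A d-th power with p ∣ d is a p-th power, and its p-th root is nonzero because γ is.
  prime-free⇒free : ∀ {n γ} .{{_ : NonZero n}} → γ ≢ 0# →
                    (∀ {p} → Prime p → p ∣ n → IsFree p γ) → IsFree n γ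
  prime-free⇒free {n} {γ} γ≢0 prime-free = γ≢0 , λ (β , d , _ , d∣n , d≢1 , γ≡βᵈ) →
    let p , p-prime , p∣d = prime-divisor (λ { refl → ℕ.≢-nonZero⁻¹ n (0∣⇒≡0 d∣n) }) d≢1
        instance p≢0 = prime⇒nonZero p-prime
        divides c d≡c*p = p∣d
        γ≡[βᶜ]ᵖ : γ ≡ pow (pow β c) p
        γ≡[βᶜ]ᵖ = trans γ≡βᵈ (trans (cong (pow β) (trans d≡c*p (ℕₚ.*-comm c p)))
                                   (pow-* β p c))
        βᶜ≢0 : pow β c ≢ 0#
        βᶜ≢0 βᶜ≡0 = γ≢0 (trans γ≡[βᶜ]ᵖ (trans (cong (λ y → pow y p) βᶜ≡0) (pow-0# p)))
        p≢1 : p ≢ 1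
        p≢1 p≡1 = ¬prime[1] (subst Prime p≡1 p-prime)
    in proj₂ (prime-free p-prime (∣-trans p∣d d∣n)) (pow β c , p , βᶜ≢0 , ∣-refl , p≢1 , γ≡[βᶜ]ᵖ)

  free-mono : ∀ {m n γ} .{{_ : NonZero n}} → PrimeDivisorsDivide n m → IsFree m γ → IsFree n γ
  free-mono n⊑m γ-free =
    prime-free⇒free (proj₁ γ-free) λ p-prime p∣n → free-∣ (n⊑m p-prime p∣n) γ-free

  free-* : ∀ {m l γ} .{{_ : NonZero (m * l)}} → IsFree m γ → IsFree l γ → IsFree (m * l) γ
  free-* {m} {l} m-free l-free = prime-free⇒free (proj₁ m-free) λ p-prime p∣ml →
    [ (λ p∣m → free-∣ p∣m m-free) , (λ p∣l → free-∣ p∣l l-free) ]′ (euclidsLemma m l p-prime p∣ml)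

module _ {a p q} {X : Set a} {P : Pred X p} {Q : Pred X q} where

  length-filter-mono : (P? : Decidable P) (Q? : Decidable Q) → P ⊆ Q → ∀ xs →
               length (filter P? xs) ℕ.≤ length (filter Q? xs)
  length-filter-mono P? Q? P⊆Q xs =
    length-mono-≤ (filter⁺ P? Q? (λ { refl → P⊆Q }) (⊆-refl {x = xs}))

  length-filter-inclusion-exclusion : (P? : Decidable P) (Q? : Decidable Q) → ∀ xs →
    length (filter P? xs) ℕ.+ length (filter Q? xs) ≡
    length (filter (P? ∩? Q?) xs) ℕ.+ length (filter (P? ∪? Q?) xs)
  length-filter-inclusion-exclusion P? Q? [] = refl
  length-filter-inclusion-exclusion P? Q? (x ∷ xs)
    with does (P? x) | does (Q? x) | length-filter-inclusion-exclusion P? Q? xs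
  ... | false | false | ih = ih
  ... | true  | false | ih = trans (cong ℕ.suc ih) (sym (ℕₚ.+-suc _ _))
  ... | false | true  | ih = trans (ℕₚ.+-suc _ _) (trans (cong ℕ.suc ih) (sym (ℕₚ.+-suc _ _)))
  ... | true  | true  | ih =
    cong ℕ.suc (trans (ℕₚ.+-suc _ _) (trans (cong ℕ.suc ih) (sym (ℕₚ.+-suc _ _))))

ℕtoℚ≡mkℚ : ∀ n → ℕtoℚ n ≡ mkℚ (+ n) 0 (coprime-sym (1-coprimeTo n))
ℕtoℚ≡mkℚ n = ℚₚ.normalize-coprime (coprime-sym (1-coprimeTo n))

ℕtoℚ-homo-+ : ∀ m n → ℕtoℚ (m ℕ.+ n) ≡ ℕtoℚ m + ℕtoℚ n
ℕtoℚ-homo-+ m n rewrite ℕtoℚ≡mkℚ m | ℕtoℚ≡mkℚ n = cong (_/ 1)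
  (trans (ℤₚ.pos-+ m n) (sym (cong₂ ℤ._+_ (ℤₚ.*-identityʳ (+ m)) (ℤₚ.*-identityʳ (+ n)))))

ℕtoℚ-mono-≤ : ∀ {m n} → m ℕ.≤ n → ℕtoℚ m ℚ.≤ ℕtoℚ n
ℕtoℚ-mono-≤ {m} {n} m≤n rewrite ℕtoℚ≡mkℚ m | ℕtoℚ≡mkℚ n =
  *≤* (ℤₚ.*-monoʳ-≤-nonNeg (+ 1) (ℤ.+≤+ m≤n))

sieve-step : ∀ x y z a r E S → x + y ℚ.≤ z + a →
             x - (r + E) *ℚ a + ((y - (1ℚ - r) *ℚ a) + S) ℚ.≤ z - E *ℚ a + S
sieve-step x y z a r E S x+y≤z+a = begin
  x - (r + E) *ℚ a + ((y - (1ℚ - r) *ℚ a) + S) ≡⟨ regroupˡ x y a r E S ⟩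
  (x + y) + (ℚ.- a - E *ℚ a + S)               ≤⟨ ℚₚ.+-monoˡ-≤ (ℚ.- a - E *ℚ a + S) x+y≤z+a ⟩
  (z + a) + (ℚ.- a - E *ℚ a + S)               ≡⟨ regroupʳ z a E S ⟩
  z - E *ℚ a + S                               ∎
  where
  open ℚₚ.≤-Reasoning
  open +-*-Solver
  regroupˡ : ∀ x y a r E S → x - (r + E) *ℚ a + ((y - (1ℚ - r) *ℚ a) + S)
                             ≡ (x + y) + (ℚ.- a - E *ℚ a + S)
  regroupˡ = solve 6 (λ x y a r E S → x :- (r :+ E) :* a :+ ((y :- (con 1ℚ :- r) :* a) :+ S)
                                      := (x :+ y) :+ (:- a :- E :* a :+ S)) refl
  regroupʳ : ∀ z a E S → (z + a) + (ℚ.- a - E *ℚ a + S) ≡ z - E *ℚ a + S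
  regroupʳ = solve 4 (λ z a E S → (z :+ a) :+ (:- a :- E :* a :+ S) := z :- E :* a :+ S) refl

module Sieve (F : FiniteField) (A : FiniteField.Subset F) where
  open FiniteField F using (N; size; elements; IsFree; free?)
  open Freeness F

  in-A? : Decidable (λ γ → T (A γ))
  in-A? γ = T? (A γ)

  free-in-A? : ∀ m .{{_ : NonZero m}} → Decidable (λ γ → T (A γ) × IsFree m γ)
  free-in-A? m γ = T? (A γ) ×-dec free? m γ

  N-mono : ∀ m n .{{_ : NonZero m}} .{{_ : NonZero n}} →
           PrimeDivisorsDivide n m → N m A ℕ.≤ N n A
  N-mono m n n⊑m = length-filter-mono (free-in-A? m) (free-in-A? n)
    (λ (γ∈A , γ-free) → γ∈A , free-mono n⊑m γ-free) elements

  N-+-≤ : ∀ m l .{{_ : NonZero m}} .{{_ : NonZero l}} →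
          N m A ℕ.+ N l A ℕ.≤ N (m * l) {{m*n≢0 m l}} A ℕ.+ size A
  N-+-≤ m l = begin
    N m A ℕ.+ N l A
      ≡⟨ length-filter-inclusion-exclusion (free-in-A? m) (free-in-A? l) elements ⟩
    length (filter (free-in-A? m ∩? free-in-A? l) elements) ℕ.+
    length (filter (free-in-A? m ∪? free-in-A? l) elements)
      ≤⟨ ℕₚ.+-mono-≤ (length-filter-mono _ (free-in-A? (m * l)) both-free⇒free elements)
                     (length-filter-mono _ in-A? [ proj₁ , proj₁ ]′ elements) ⟩
    N (m * l) A ℕ.+ size A
      ∎
    where
    open ℕₚ.≤-Reasoning
    instance _ = m*n≢0 m l
    both-free⇒free : ∀ {γ} → (T (A γ) × IsFree m γ) × (T (A γ) × IsFree l γ) →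
                     T (A γ) × IsFree (m * l) γ
    both-free⇒free ((γ∈A , m-free) , (_ , l-free)) = γ∈A , free-* m-free l-free

  |A| : ℚ
  |A| = ℕtoℚ (size A)

  sieve-term : Σ ℕ Prime → ℚ
  sieve-term (l , l-prime) =
    ℕtoℚ (N l {{prime⇒nonZero l-prime}} A) - (1ℚ - recipP (l , l-prime)) *ℚ |A|

  sieve : ∀ {e} .{{_ : NonZero e}} ls m .{{_ : NonZero m}} →
          PrimeDivisorsDivide e (m * prodP ls) →
          ℕtoℚ (N m A) - ε ls *ℚ |A| + sumℚ (map sieve-term ls) ℚ.≤ ℕtoℚ (N e A)
  sieve {e} [] m e⊑m*1 = begin
    ℕtoℚ (N m A) - 0ℚ *ℚ |A| + 0ℚ ≡⟨ x-0a+0≡x (ℕtoℚ (N m A)) |A| ⟩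
    ℕtoℚ (N m A)                  ≤⟨ ℕtoℚ-mono-≤ (N-mono m e e⊑m) ⟩
    ℕtoℚ (N e A)                  ∎
    where
    open ℚₚ.≤-Reasoning
    open +-*-Solver
    x-0a+0≡x : ∀ x a → x - 0ℚ *ℚ a + 0ℚ ≡ x
    x-0a+0≡x = solve 2 (λ x a → x :- con 0ℚ :* a :+ con 0ℚ := x) refl
    e⊑m : PrimeDivisorsDivide e m
    e⊑m {p} p-prime p∣e = subst (p ∣_) (ℕₚ.*-identityʳ m) (e⊑m*1 p-prime p∣e)
  sieve {e} ((l , l-prime) ∷ ls) m e⊑m*l*∏ls = begin
    ℕtoℚ (N m A) - ε ((l , l-prime) ∷ ls) *ℚ |A| + sumℚ (map sieve-term ((l , l-prime) ∷ ls))
      ≤⟨ sieve-step (ℕtoℚ (N m A)) (ℕtoℚ (N l A)) (ℕtoℚ (N (m * l) A)) |A|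
                    (recipP (l , l-prime)) (ε ls) (sumℚ (map sieve-term ls)) N-+-≤ℚ ⟩
    ℕtoℚ (N (m * l) A) - ε ls *ℚ |A| + sumℚ (map sieve-term ls)
      ≤⟨ sieve ls (m * l) e⊑[m*l]*∏ls ⟩
    ℕtoℚ (N e A)
      ∎
    where
    open ℚₚ.≤-Reasoning
    instance
      _ = prime⇒nonZero l-prime
      _ = m*n≢0 m l
    e⊑[m*l]*∏ls : PrimeDivisorsDivide e (m * l * prodP ls)
    e⊑[m*l]*∏ls {p} p-prime p∣e =
      subst (p ∣_) (sym (ℕₚ.*-assoc m l (prodP ls))) (e⊑m*l*∏ls p-prime p∣e)
    N-+-≤ℚ : ℕtoℚ (N m A) + ℕtoℚ (N l A) ℚ.≤ ℕtoℚ (N (m * l) A) + |A|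
    N-+-≤ℚ = subst₂ ℚ._≤_ (ℕtoℚ-homo-+ (N m A) (N l A)) (ℕtoℚ-homo-+ (N (m * l) A) (size A))
                      (ℕtoℚ-mono-≤ (N-+-≤ m l))

lemma7 : (q r : ℕ) → IsPrimePower q → 2 ≤ r →
         (F : FiniteField) → FiniteField.card F ≡ q ^ r →
         (A : FiniteField.Subset F) →
         (e : ℕ) → .{{_ : NonZero e}} → e ∣ q ^ r ∸ 1 →
         (k : ℕ) → .{{k≢0 : NonZero k}} → (ps ls : Primes) →
         rad e ≡ k * prodP ps * prodP ls →
         ℕtoℚ (FiniteField.N F e A)
           ≥ ℕtoℚ (FiniteField.N F (k * prodP ps) {{m*n≢0 k (prodP ps) {{k≢0}} {{prodP-nonZero ps}}}} A)
             - ε ls *ℚ ℕtoℚ (FiniteField.size F A)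
             + sumℚ (map (λ l → ℕtoℚ (FiniteField.N F (proj₁ l) {{prime⇒nonZero (proj₂ l)}} A)
                                - (1ℚ - recipP l) *ℚ ℕtoℚ (FiniteField.size F A)) ls)
lemma7 _ _ _ _ F _ A e _ k {{k≢0}} ps ls rad-e≡k*∏ps*∏ls =
  Sieve.sieve F A ls (k * prodP ps) {{m*n≢0 k (prodP ps) {{k≢0}} {{prodP-nonZero ps}}}}
    λ p-prime p∣e → subst (_ ∣_) rad-e≡k*∏ps*∏ls (prime∣⇒∣rad p-prime p∣e)
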